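{- Let $X=\{1,\dots,n\}$, $\boldsymbol{\alpha}=(\alpha_1,\dots,\alpha_n)$ a sequence of nonnegative integers, $U\subseteq X\times X$ and $U^c=(X\times X)\setminus U$. Then $\operatorname{maj}'_U$ and $\operatorname{inv}'_U$ are equidistributed on $\mathcal{R}(\boldsymbol{\alpha})$ if and only if $\operatorname{maj}'_{U^c}$ and $\operatorname{inv}'_{U^c}$ are equidistributed on $\mathcal{R}(\boldsymbol{\alpha})$.
   Context: $\mathcal{R}(\boldsymbol{\alpha})$ is the set of words with exactly $\alpha_i$ occurrences of $i$ for each $i$. For a relation $V\subseteq X\times X$ and a word $w=x_1\cdots x_m$: $\operatorname{inv}'_V w=\#\{(i,j):1\le i<j\le m,\ (x_i,x_j)\in V\}$, $\operatorname{maj}'_V w=\sum i$ over $1\le i\le m-1$ with $(x_i,x_{i+1})\in V$. Two statistics $f,g$ are equidistributed on $\mathcal{R}(\boldsymbol{\alpha})$ if $\sum_{w\in\mathcal{R}(\boldsymbol{\alpha})}q^{f(w)}=\sum_{w\in\mathcal{R}(\boldsymbol{\alpha})}q^{g(w)}$. -}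

module Defs where

open import Data.Nat using (ℕ; zero; suc; _+_; _≡ᵇ_)
open import Data.Bool using (Bool; true; false; not; if_then_else_; _∧_)
open import Data.Fin using (Fin; _≟_)
open import Data.Fin.Base using () 
open import Data.List using (List; []; _∷_; map; concatMap; filter; length; allFin)
open import Data.List.Relation.Unary.All using (All)
open import Relation.Nullary.Decidable using (⌊_⌋)
open import Relation.Binary.PropositionalEquality using (_≡_)

-- A relation V ⊆ X × X on X = {1..n} (represented as Fin n), given by its
-- (decidable) characteristic function.
Rel : ℕ → Set
Rel n = Fin n → Fin n → Bool

compl : ∀ {n} → Rel n → Rel n
compl U x y = not (U x y)

count : ∀ {n} → Fin n → List (Fin n) → ℕ
count i [] = 0
count i (x ∷ w) = (if ⌊ i ≟ x ⌋ then 1 else 0) + count i w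

words : ∀ n → ℕ → List (List (Fin n))
words n zero = [] ∷ []
words n (suc m) = concatMap (λ x → map (x ∷_) (words n m)) (allFin n)

sumF : ∀ {n} → (Fin n → ℕ) → ℕ
sumF {zero} f = 0
sumF {suc n} f = f Fin.zero + sumF (λ i → f (Fin.suc i))

hasContent : ∀ {n} → (Fin n → ℕ) → List (Fin n) → Bool
hasContent {n} α w = allB (allFin n)
  where
  allB : List (Fin n) → Bool
  allB [] = true
  allB (i ∷ is) = (count i w ≡ᵇ α i) ∧ allB is

-- R(α): the set of words with exactly α i occurrences of i, enumerated as a list
-- (every such word has length Σ α i).
R : ∀ {n} → (Fin n → ℕ) → List (List (Fin n))
R {n} α = filter (λ w → hasContent α w Data.Bool.≟ true) (words n (sumF α))

-- inv'_V w = #{(i,j) : i < j, (x_i, x_j) ∈ V}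
inv' : ∀ {n} → Rel n → List (Fin n) → ℕ
inv' V [] = 0
inv' V (x ∷ w) = countB (λ y → V x y) w + inv' V w
  where
  countB : _ → List _ → ℕ
  countB p [] = 0
  countB p (y ∷ ys) = (if p y then 1 else 0) + countB p ys

-- maj'_V w = Σ i over 1 ≤ i ≤ m-1 with (x_i, x_{i+1}) ∈ V (positions 1-based)
majFrom : ∀ {n} → Rel n → ℕ → List (Fin n) → ℕ
majFrom V i [] = 0
majFrom V i (x ∷ []) = 0
majFrom V i (x ∷ y ∷ w) = (if V x y then i else 0) + majFrom V (suc i) (y ∷ w)

maj' : ∀ {n} → Rel n → List (Fin n) → ℕ
maj' V w = majFrom V 1 w

-- Equidistribution on a finite list of words: Σ_w q^{f w} = Σ_w q^{g w},
-- i.e. equality of the generating polynomials coefficientwise: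
-- for every k, #{w : f w = k} = #{w : g w = k}.
numWith : ∀ {n} → (List (Fin n) → ℕ) → ℕ → List (List (Fin n)) → ℕ
numWith f k [] = 0
numWith f k (w ∷ ws) = (if f w ≡ᵇ k then 1 else 0) + numWith f k ws

Equidistributed : ∀ {n} → (List (Fin n) → ℕ) → (List (Fin n) → ℕ) → List (List (Fin n)) → Set
Equidistributed f g S = ∀ k → numWith f k S ≡ numWith g k S

-- Every adjacent pair of a word is a descent for exactly one of U and U^c, and every pair of
-- positions is an inversion for exactly one of them.  Hence on words of length m,
--   maj'_U + maj'_{U^c} = 1 + 2 + ⋯ + (m − 1) = inv'_U + inv'_{U^c},
-- so on R(α) both pairs of statistics are obtained from each other by k ↦ C − k for the same
-- constant C, and this reflection preserves equidistribution.
module Submission where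

open import Defs
open import Data.Nat using (ℕ; zero; suc; _+_; _∸_; _≤_; _<_; _≟_; _≤?_)
open import Data.Nat.Properties
  using (+-comm; +-identityʳ; +-commutativeSemigroup; m+n∸n≡m; m+n∸m≡n;
         m∸[m∸n]≡n; m≤n+m; <⇒≱; ≰⇒>; +-cancelʳ-≡)
open import Algebra.Properties.CommutativeSemigroup +-commutativeSemigroup
  using (interchange; x∙yz≈y∙xz)
open import Data.Bool using (Bool; true; false; not; if_then_else_)
open import Data.Fin using (Fin)
open import Data.List using (List; []; _∷_; length; allFin)
open import Data.List.Relation.Unary.All as All using (All; []; _∷_)
import Data.List.Relation.Unary.All.Properties as All
open import Function.Bundles using (_⇔_; mk⇔)
open import Relation.Binary.PropositionalEquality
open import Relation.Nullary using (yes; no; ¬_)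
open import Relation.Nullary.Decidable using (does-⇔; dec-false)

private
  variable
    n : ℕ

Word : ℕ → Set
Word n = List (Fin n)

numWith-cong : ∀ {f g : Word n → ℕ} {k l} S →
  All (λ w → (f w ≡ k) ⇔ (g w ≡ l)) S → numWith f k S ≡ numWith g l S
numWith-cong [] [] = refl
numWith-cong {f = f} {g} {k} {l} (w ∷ S) (f≡k⇔g≡l ∷ rest) =
  cong₂ (λ b r → (if b then 1 else 0) + r)
        (does-⇔ f≡k⇔g≡l (f w ≟ k) (g w ≟ l))
        (numWith-cong S rest)

numWith-absent : ∀ {f : Word n → ℕ} {k} S → All (λ w → ¬ f w ≡ k) S → numWith f k S ≡ 0
numWith-absent [] [] = refl
numWith-absent {f = f} {k} (w ∷ S) (f≢k ∷ rest)
  rewrite dec-false (f w ≟ k) f≢k = numWith-absent S rest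

module _ {a b C k : ℕ} (a+b≡C : a + b ≡ C) where

  complement-≡-⇔ : k ≤ C → (b ≡ k) ⇔ (a ≡ C ∸ k)
  complement-≡-⇔ k≤C = mk⇔
    (λ b≡k → begin
      a           ≡⟨ m+n∸n≡m a b ⟨
      a + b ∸ b   ≡⟨ cong₂ _∸_ a+b≡C b≡k ⟩
      C ∸ k       ∎)
    (λ a≡C∸k → begin
      b             ≡⟨ m+n∸m≡n a b ⟨
      a + b ∸ a     ≡⟨ cong₂ _∸_ a+b≡C a≡C∸k ⟩
      C ∸ (C ∸ k)   ≡⟨ m∸[m∸n]≡n k≤C ⟩
      k             ∎)
    where open ≡-Reasoning

  complement-≢ : C < k → ¬ b ≡ k
  complement-≢ C<k refl = <⇒≱ C<k (subst (k ≤_) a+b≡C (m≤n+m k a))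

SumsTo : (Word n → ℕ) → (Word n → ℕ) → ℕ → List (Word n) → Set
SumsTo f f′ C = All (λ w → f w + f′ w ≡ C)

equidistributed-complement : ∀ {f f′ g g′ : Word n → ℕ} {C} S →
  SumsTo f f′ C S → SumsTo g g′ C S → Equidistributed f g S → Equidistributed f′ g′ S
equidistributed-complement {f = f} {f′} {g} {g′} {C} S f+f′ g+g′ f∼g k with k ≤? C
... | yes k≤C = begin
  numWith f′ k S        ≡⟨ numWith-cong S (All.map (λ e → complement-≡-⇔ e k≤C) f+f′) ⟩
  numWith f (C ∸ k) S   ≡⟨ f∼g (C ∸ k) ⟩
  numWith g (C ∸ k) S   ≡⟨ numWith-cong S (All.map (λ e → complement-≡-⇔ e k≤C) g+g′) ⟨
  numWith g′ k S        ∎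
  where open ≡-Reasoning
... | no k≰C = trans (numWith-absent S (All.map (λ e → complement-≢ e (≰⇒> k≰C)) f+f′))
                     (sym (numWith-absent S (All.map (λ e → complement-≢ e (≰⇒> k≰C)) g+g′)))

if-+-if-not : ∀ b (i : ℕ) → (if b then i else 0) + (if not b then i else 0) ≡ i
if-+-if-not true  i = +-identityʳ i
if-+-if-not false i = refl

triangular : ℕ → ℕ
triangular zero    = 0
triangular (suc m) = m + triangular m

positionSum : ℕ → ℕ → ℕ
positionSum i zero             = 0
positionSum i (suc zero)       = 0
positionSum i (suc (suc m))    = i + positionSum (suc i) (suc m)

positionSum-suc : ∀ i m → positionSum (suc i) (suc m) ≡ m + positionSum i (suc m)
positionSum-suc i zero    = refl
positionSum-suc i (suc m) = begin
  suc i + positionSum (suc (suc i)) (suc m)   ≡⟨ cong (suc i +_) (positionSum-suc (suc i) m) ⟩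
  suc i + (m + positionSum (suc i) (suc m))   ≡⟨ cong suc (x∙yz≈y∙xz i m _) ⟩
  suc m + (i + positionSum (suc i) (suc m))   ∎
  where open ≡-Reasoning

positionSum-one : ∀ m → positionSum 1 m ≡ triangular m
positionSum-one zero          = refl
positionSum-one (suc zero)    = refl
positionSum-one (suc (suc m)) =
  cong suc (trans (positionSum-suc 1 m) (cong (m +_) (positionSum-one (suc m))))

majFrom-+-compl : ∀ (U : Rel n) i w →
  majFrom U i w + majFrom (compl U) i w ≡ positionSum i (length w)
majFrom-+-compl U i []          = refl
majFrom-+-compl U i (x ∷ [])    = refl
majFrom-+-compl U i (x ∷ y ∷ w) = begin
  ((if U x y then i else 0) + majFrom U (suc i) (y ∷ w))
    + ((if not (U x y) then i else 0) + majFrom (compl U) (suc i) (y ∷ w))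
                                  ≡⟨ interchange (if U x y then i else 0) (majFrom U (suc i) (y ∷ w)) _ _ ⟩
  ((if U x y then i else 0) + (if not (U x y) then i else 0))
    + (majFrom U (suc i) (y ∷ w) + majFrom (compl U) (suc i) (y ∷ w))
                                  ≡⟨ cong₂ _+_ (if-+-if-not (U x y) i) (majFrom-+-compl U (suc i) (y ∷ w)) ⟩
  i + positionSum (suc i) (suc (length w))   ∎
  where open ≡-Reasoning

maj'-+-compl : ∀ (U : Rel n) w → maj' U w + maj' (compl U) w ≡ triangular (length w)
maj'-+-compl U w = trans (majFrom-+-compl U 1 w) (positionSum-one (length w))

countIn : (Fin n → Bool) → Word n → ℕ
countIn p []       = 0
countIn p (y ∷ ys) = (if p y then 1 else 0) + countIn p ys

countIn-+-not : ∀ (p : Fin n → Bool) ys → countIn p ys + countIn (λ y → not (p y)) ys ≡ length ys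
countIn-+-not p []       = refl
countIn-+-not p (y ∷ ys) =
  trans (interchange (if p y then 1 else 0) (countIn p ys) (if not (p y) then 1 else 0) _)
        (cong₂ _+_ (if-+-if-not (p y) 1) (countIn-+-not p ys))

-- inv' counts the pairs headed by x with a counter local to its definition; this exposes it.
inv'-∷ : ∀ (V : Rel n) x ys → inv' V (x ∷ ys) ≡ countIn (V x) ys + inv' V ys
inv'-∷ V x []       = refl
inv'-∷ V x (y ∷ ys) =
  cong (λ c → (if V x y then 1 else 0) + c + inv' V (y ∷ ys))
       (+-cancelʳ-≡ (inv' V ys) _ _ (inv'-∷ V x ys))

inv'-+-compl : ∀ (U : Rel n) w → inv' U w + inv' (compl U) w ≡ triangular (length w)
inv'-+-compl U []      = refl
inv'-+-compl U (x ∷ w) = begin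
  inv' U (x ∷ w) + inv' (compl U) (x ∷ w)
    ≡⟨ cong₂ _+_ (inv'-∷ U x w) (inv'-∷ (compl U) x w) ⟩
  (countIn (U x) w + inv' U w) + (countIn (compl U x) w + inv' (compl U) w)
    ≡⟨ interchange (countIn (U x) w) (inv' U w) (countIn (compl U x) w) _ ⟩
  (countIn (U x) w + countIn (compl U x) w) + (inv' U w + inv' (compl U) w)
    ≡⟨ cong₂ _+_ (countIn-+-not (U x) w) (inv'-+-compl U w) ⟩
  length w + triangular (length w)   ∎
  where open ≡-Reasoning

words-length : ∀ n m → All (λ w → length w ≡ m) (words n m)
words-length n zero    = refl ∷ []
words-length n (suc m) = All.concat⁺ (All.map⁺ (All.universal
  (λ x → All.map⁺ (All.map (cong suc) (words-length n m))) (allFin n)))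

R-length : (α : Fin n → ℕ) → All (λ w → length w ≡ sumF α) (R α)
R-length {n} α = All.filter⁺ _ (words-length n (sumF α))

lemma3p1 : (n : ℕ) (α : Fin n → ℕ) (U : Rel n) →
    Equidistributed (maj' U) (inv' U) (R α)
      ⇔ Equidistributed (maj' (compl U)) (inv' (compl U)) (R α)
lemma3p1 n α U = mk⇔
  (reflect U (compl U) (maj'-+-compl U) (inv'-+-compl U))
  (reflect (compl U) U (+-compl-comm maj' (maj'-+-compl U)) (+-compl-comm inv' (inv'-+-compl U)))
  where
  Complementary : (Rel n → Word n → ℕ) → Rel n → Rel n → Set
  Complementary stat V W = ∀ w → stat V w + stat W w ≡ triangular (length w)

  +-compl-comm : ∀ stat → Complementary stat U (compl U) → Complementary stat (compl U) U
  +-compl-comm stat sum w = trans (+-comm (stat (compl U) w) (stat U w)) (sum w)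

  on-R : ∀ stat V W → Complementary stat V W → SumsTo (stat V) (stat W) (triangular (sumF α)) (R α)
  on-R stat V W sum = All.map (λ {w} ∣w∣≡ → trans (sum w) (cong triangular ∣w∣≡)) (R-length α)

  reflect : ∀ V W → Complementary maj' V W → Complementary inv' V W →
            Equidistributed (maj' V) (inv' V) (R α) → Equidistributed (maj' W) (inv' W) (R α)
  reflect V W maj-sum inv-sum = equidistributed-complement
    (R α) (on-R maj' V W maj-sum) (on-R inv' V W inv-sum)
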